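{- Let $P$ be a process satisfying \texttt{positive bid-ask spread} and \texttt{conservation}. Then for every order-domain $(B,A)$ and instruction $\tau$ such that $((B,A),\tau)$ is a legal-input, if $P(B,A,\tau)=(\hat B,\hat A,M)$, then every matching $M'$ over the order-domain $\mathsf{Absorb}(B,A,\tau)$ satisfies $\mathsf{Vol}(M)\ge \mathsf{Vol}(M')$.
   Context: An order is a 4-tuple $\omega=(\mathsf{id}(\omega),\mathsf{timestamp}(\omega),\mathsf{qty}(\omega),\mathsf{price}(\omega))$ of natural numbers with $\mathsf{qty}(\omega)>0$. An order-domain is a pair $(B,A)$ of finite sets of orders ($B$ = bids, $A$ = asks); it is admissible if all orders in $B\cup A$ have pairwise distinct ids and pairwise distinct timestamps. A bid $b$ and ask $a$ are tradable if $\mathsf{price}(b)\ge\mathsf{price}(a)$; $(B,A)$ is matchable if some $b\in B$, $a\in A$ are tradable. A transaction is a triple $t=(\mathsf{id_{bid}}(t),\mathsf{id_{ask}}(t),\mathsf{qty}(t))$ of natural numbers with $\mathsf{qty}(t)>0$. It is valid w.r.t. $(B,A)$ if there are $b\in B$, $a\in A$ with $\mathsf{id_{bid}}(t)=\mathsf{id}(b)$, $\mathsf{id_{ask}}(t)=\mathsf{id}(a)$, $b,a$ tradable, and $\mathsf{qty}(t)\le\min(\mathsf{qty}(b),\mathsf{qty}(a))$. For a finite set of transactions $T$ and an id, $\mathsf{Qty}(T,id)$ is the sum of quantities of transactions in $T$ whose bid id (for bids) resp. ask id (for asks) equals $id$; $\mathsf{Vol}(T)$ is the sum of all transaction quantities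 in $T$; $\mathsf{ids_{bid}}(T),\mathsf{ids_{ask}}(T)$ are the sets of bid/ask ids occurring in $T$. A matching over an admissible $(B,A)$ is a set $M$ of transactions valid w.r.t. $(B,A)$ such that $\mathsf{Qty}(M,\mathsf{id}(\omega))\le\mathsf{qty}(\omega)$ for every $\omega\in B\cup A$. $\mathsf{Bids}(M,B)$ is the set of bids in $B$ occurring in $M$, each with its quantity replaced by its total traded quantity $\mathsf{Qty}(M,\mathsf{id}(b))$; $\mathsf{Asks}(M,A)$ likewise. A set of orders is also viewed as a multiset in which each order (with its quantity field suppressed) has multiplicity equal to its quantity; $S_1-S_2$ denotes multiset difference (so it reduces quantities, removing orders whose quantity reaches $0$), while $S_1\setminus S_2$ is ordinary set difference. An instruction is $\mathsf{Buy}\ \beta$, $\mathsf{Sell}\ \alpha$, or $\mathsf{Del}\ \omega$ (for $\mathsf{Del}$ only $id=\mathsf{id}(\omega)$ matters). $\mathsf{Absorb}(B,A,\mathsf{Del}\ id)=(\{b\in B:\mathsf{id}(b)\ne id\},\{a\in A:\mathsf{id}(a)\ne id\})$, $\mathsf{Absorb}(B,A,\mathsf{Buy}\ \beta)=(B\cup\{\beta\},A)$, $\mathsf{Absorb}(B,A,\mathsf{Sell}\ \alpha)=(B,A\cup\{\alpha\})$. $((B,A),\tau)$ is a legal-input if $(B,A)$ is not matchable and $\mathsf{Absorb}(B,A,\tau)$ is admissible. A process is a function $P:(B,A,\tau)\mapsto(\hat B,\hat A,M)$ from two sets of orders and an instruction to two sets of orders and a set of transactions. $P$ satisfies \texttt{positive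 bid-ask spread} if for every legal-input $((B,A),\tau)$ with $P(B,A,\tau)=(\hat B,\hat A,M)$, $(\hat B,\hat A)$ is not matchable. $P$ satisfies \texttt{conservation} if for every such legal-input, with $(B',A')=\mathsf{Absorb}(B,A,\tau)$: $M$ is a matching over $(B',A')$, $\hat B=B'-\mathsf{Bids}(M,B')$ and $\hat A=A'-\mathsf{Asks}(M,A')$. -}

module Defs where

open import Data.Nat using (_⊓_; ℕ; zero; suc; _+_; _∸_; _≤_; _<_; _≥_; _≟_; _<?_)
open import Data.List using (List; []; _∷_; _++_; map; filter)
open import Data.Nat.ListAction using (sum)
open import Data.List.Membership.Propositional using (_∈_)
open import Data.List.Relation.Unary.Unique.Propositional using (Unique)
open import Data.Product using (Σ; ∃; ∃-syntax; _×_; _,_)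
open import Relation.Nullary using (¬_; yes; no)
open import Relation.Nullary.Decidable using (⌊_⌋; _×-dec_; ¬?)
open import Relation.Binary.PropositionalEquality using (_≡_)
open import Data.Bool using (Bool; true; false; if_then_else_)

-- An order (id, timestamp, qty, price).  Positivity of qty is imposed
-- separately (see WfOrders / LegalInput).
record Order : Set where
  constructor order
  field
    oid       : ℕ
    timestamp : ℕ
    qty       : ℕ
    price     : ℕ
open Order public

record Transaction : Set where
  constructor transaction
  field
    idBid : ℕ
    idAsk : ℕ
    tqty  : ℕ
open Transaction public

-- Finite sets are represented by lists, read up to membership.
_≋_ : {X : Set} → List X → List X → Set
xs ≋ ys = ∀ x → (x ∈ xs → x ∈ ys) × (x ∈ ys → x ∈ xs)

WfOrders : List Order → Set
WfOrders S = ∀ ω → ω ∈ S → 0 < qty ω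

Admissible : List Order → List Order → Set
Admissible B A =
  ∀ ω ω′ → ω ∈ B ++ A → ω′ ∈ B ++ A →
    (oid ω ≡ oid ω′ → ω ≡ ω′) × (timestamp ω ≡ timestamp ω′ → ω ≡ ω′)

Tradable : Order → Order → Set
Tradable b a = price b ≥ price a

Matchable : List Order → List Order → Set
Matchable B A = ∃[ b ] ∃[ a ] (b ∈ B × a ∈ A × Tradable b a)

ValidTx : List Order → List Order → Transaction → Set
ValidTx B A t =
  0 < tqty t ×
  ∃[ b ] ∃[ a ] (b ∈ B × a ∈ A × idBid t ≡ oid b × idAsk t ≡ oid a ×
                 Tradable b a × tqty t ≤ (qty b ⊓ qty a))

QtyBid : List Transaction → ℕ → ℕ
QtyBid T i = sum (map tqty (filter (λ t → idBid t ≟ i) T))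

QtyAsk : List Transaction → ℕ → ℕ
QtyAsk T i = sum (map tqty (filter (λ t → idAsk t ≟ i) T))

Vol : List Transaction → ℕ
Vol T = sum (map tqty T)

-- A matching over (B, A); Unique makes the list a genuine set of transactions.
Matching : List Order → List Order → List Transaction → Set
Matching B A M =
  Unique M ×
  (∀ t → t ∈ M → ValidTx B A t) ×
  (∀ b → b ∈ B → QtyBid M (oid b) ≤ qty b) ×
  (∀ a → a ∈ A → QtyAsk M (oid a) ≤ qty a)

withQty : Order → ℕ → Order
withQty ω q = order (oid ω) (timestamp ω) q (price ω)

tradedWith : (List Transaction → ℕ → ℕ) → List Transaction → List Order → List Order
tradedWith Q M [] = []
tradedWith Q M (ω ∷ S) with 0 <? Q M (oid ω)
... | yes _ = withQty ω (Q M (oid ω)) ∷ tradedWith Q M S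
... | no  _ = tradedWith Q M S

Bids : List Transaction → List Order → List Order
Bids = tradedWith QtyBid

Asks : List Transaction → List Order → List Order
Asks = tradedWith QtyAsk

-- Multiset difference S₁ - S₂ (orders compared with quantity suppressed,
-- multiplicity = quantity).  S₂ is a set, so each order (without quantity)
-- occurs in it at most once; we take the first occurrence.
sameOrder : Order → Order → Bool
sameOrder ω ω′ = ⌊ (oid ω ≟ oid ω′) ×-dec ((timestamp ω ≟ timestamp ω′) ×-dec (price ω ≟ price ω′)) ⌋

multiplicity : Order → List Order → ℕ
multiplicity ω [] = 0
multiplicity ω (ω′ ∷ S) = if sameOrder ω ω′ then qty ω′ else multiplicity ω S

_−ₘ_ : List Order → List Order → List Order
[] −ₘ S₂ = []
(ω ∷ S₁) −ₘ S₂ with 0 <? (qty ω ∸ multiplicity ω S₂)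
... | yes _ = withQty ω (qty ω ∸ multiplicity ω S₂) ∷ (S₁ −ₘ S₂)
... | no  _ = S₁ −ₘ S₂

data Instruction : Set where
  Buy  : Order → Instruction
  Sell : Order → Instruction
  Del  : Order → Instruction

instrOrder : Instruction → Order
instrOrder (Buy ω)  = ω
instrOrder (Sell ω) = ω
instrOrder (Del ω)  = ω

Absorb : List Order → List Order → Instruction → List Order × List Order
Absorb B A (Del ω)  = filter (λ b → ¬? (oid b ≟ oid ω)) B , filter (λ a → ¬? (oid a ≟ oid ω)) A
Absorb B A (Buy β)  = β ∷ B , A
Absorb B A (Sell α) = B , α ∷ A

fstP : List Order × List Order → List Order
fstP (x , _) = x

sndP : List Order × List Order → List Order
sndP (_ , y) = y

LegalInput : List Order → List Order → Instruction → Set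
LegalInput B A τ =
  WfOrders B × WfOrders A × 0 < qty (instrOrder τ) ×
  ¬ Matchable B A ×
  Admissible (fstP (Absorb B A τ)) (sndP (Absorb B A τ))

Process : Set
Process = List Order → List Order → Instruction →
          List Order × List Order × List Transaction

PositiveBidAskSpread : Process → Set
PositiveBidAskSpread P =
  ∀ B A τ → LegalInput B A τ →
  ∀ B̂ Â M → P B A τ ≡ (B̂ , Â , M) → ¬ Matchable B̂ Â

Conservation : Process → Set
Conservation P =
  ∀ B A τ → LegalInput B A τ →
  ∀ B̂ Â M → P B A τ ≡ (B̂ , Â , M) →
  let B′ = fstP (Absorb B A τ) ; A′ = sndP (Absorb B A τ) in
  Matching B′ A′ M ×
  B̂ ≋ (B′ −ₘ Bids M B′) ×
  Â ≋ (A′ −ₘ Asks M A′)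

-- Every transaction of a matching over the absorbed book involves a tradable pair, and the
-- book before the instruction had none; so a deletion admits only the empty matching, and
-- after a new bid β (dually, a new ask) every transaction of any matching M′ trades β against
-- an ask tradable with β.  If the process fills β, then Vol M′ ≤ qty β ≤ Vol M.  Otherwise a
-- remnant of β stays on the book, and positive spread forces every ask tradable with β to be
-- exhausted by M; so each such ask trades at least as much in M as in M′, and summing over
-- asks gives Vol M′ ≤ Vol M.
module Submission where

open import Defs
open import Algebra.Properties.CommutativeSemigroup using (x∙yz≈y∙xz)
open import Data.Bool using (true; false; T)
open import Data.Empty using (⊥-elim)
open import Data.List using (List; []; _∷_; map; filter)
open import Data.List.Membership.Propositional using (_∈_)
open import Data.List.Membership.Propositional.Properties using (∈-filter⁻; ∈-map⁺; ∈-map⁻)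
open import Data.List.Properties using (filter-all; filter-none; filter-accept; filter-reject)
open import Data.List.Relation.Binary.Subset.Propositional using (_⊆_)
open import Data.List.Relation.Binary.Subset.Propositional.Properties using (filter-⊆)
open import Data.List.Relation.Unary.All as All using ()
open import Data.List.Relation.Unary.Any using (here; there)
open import Data.Nat using (ℕ; _+_; _∸_; _≤_; _<_; _≟_; _<?_; _≤?_; z≤n)
open import Data.Nat.ListAction using (sum)
open import Data.Nat.Properties
open import Data.Product using (_×_; _,_; ∃-syntax; proj₁; proj₂)
open import Data.Unit using (tt)
open import Function using (_∘_)
open import Relation.Nullary using (¬_; yes; no)
open import Relation.Nullary.Decidable using (¬?; toWitness)
open import Relation.Binary.PropositionalEquality
  using (_≡_; _≢_; refl; sym; trans; cong; cong₂; subst; module ≡-Reasoning)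

module _ (key : Transaction → ℕ) where

  -- QtyOf idBid and QtyOf idAsk are definitionally QtyBid and QtyAsk.
  QtyOf : List Transaction → ℕ → ℕ
  QtyOf T i = sum (map tqty (filter (λ t → key t ≟ i) T))

  without : ℕ → List Transaction → List Transaction
  without i = filter (λ t → ¬? (key t ≟ i))

  module _ {t : Transaction} {T : List Transaction} {i : ℕ} where

    QtyOf-∷-same : key t ≡ i → QtyOf (t ∷ T) i ≡ tqty t + QtyOf T i
    QtyOf-∷-same p = cong (sum ∘ map tqty) (filter-accept (λ t → key t ≟ i) p)

    QtyOf-∷-other : key t ≢ i → QtyOf (t ∷ T) i ≡ QtyOf T i
    QtyOf-∷-other p = cong (sum ∘ map tqty) (filter-reject (λ t → key t ≟ i) p)

    without-∷-same : key t ≡ i → without i (t ∷ T) ≡ without i T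
    without-∷-same p = filter-reject (λ t → ¬? (key t ≟ i)) (λ ¬p → ¬p p)

    without-∷-other : key t ≢ i → without i (t ∷ T) ≡ t ∷ without i T
    without-∷-other = filter-accept (λ t → ¬? (key t ≟ i))

  Vol-split : ∀ i T → Vol T ≡ QtyOf T i + Vol (without i T)
  Vol-split i [] = refl
  Vol-split i (t ∷ T) with key t ≟ i
  ... | yes p = begin
    tqty t + Vol T                               ≡⟨ cong (tqty t +_) (Vol-split i T) ⟩
    tqty t + (QtyOf T i + Vol (without i T))     ≡⟨ +-assoc (tqty t) _ _ ⟨
    (tqty t + QtyOf T i) + Vol (without i T)     ≡⟨ cong₂ _+_ (QtyOf-∷-same p) (cong Vol (without-∷-same p)) ⟨
    QtyOf (t ∷ T) i + Vol (without i (t ∷ T))    ∎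
    where open ≡-Reasoning
  ... | no p = begin
    tqty t + Vol T                               ≡⟨ cong (tqty t +_) (Vol-split i T) ⟩
    tqty t + (QtyOf T i + Vol (without i T))     ≡⟨ x∙yz≈y∙xz +-commutativeSemigroup (tqty t) (QtyOf T i) _ ⟩
    QtyOf T i + (tqty t + Vol (without i T))     ≡⟨ cong₂ _+_ (QtyOf-∷-other p) (cong Vol (without-∷-other p)) ⟨
    QtyOf (t ∷ T) i + Vol (without i (t ∷ T))    ∎
    where open ≡-Reasoning

  QtyOf-all : ∀ T {i} → (∀ {t} → t ∈ T → key t ≡ i) → QtyOf T i ≡ Vol T
  QtyOf-all T {i} all = cong (sum ∘ map tqty) (filter-all (λ t → key t ≟ i) (All.tabulate all))

  QtyOf-none : ∀ T {i} → (∀ {t} → t ∈ T → key t ≢ i) → QtyOf T i ≡ 0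
  QtyOf-none T {i} none = cong (sum ∘ map tqty) (filter-none (λ t → key t ≟ i) (All.tabulate none))

  QtyOf≤Vol : ∀ T i → QtyOf T i ≤ Vol T
  QtyOf≤Vol T i = ≤-trans (m≤m+n (QtyOf T i) _) (≤-reflexive (sym (Vol-split i T)))

  QtyOf-without-same : ∀ i T → QtyOf (without i T) i ≡ 0
  QtyOf-without-same i T =
    QtyOf-none (without i T) (λ t∈ → proj₂ (∈-filter⁻ (λ t → ¬? (key t ≟ i)) {xs = T} t∈))

  QtyOf-∷-cong : ∀ t {X Y j} → QtyOf X j ≡ QtyOf Y j → QtyOf (t ∷ X) j ≡ QtyOf (t ∷ Y) j
  QtyOf-∷-cong t {X} {Y} {j} eq with key t ≟ j
  ... | yes p = trans (QtyOf-∷-same {T = X} p) (trans (cong (tqty t +_) eq) (sym (QtyOf-∷-same {T = Y} p)))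
  ... | no p = trans (QtyOf-∷-other {T = X} p) (trans eq (sym (QtyOf-∷-other {T = Y} p)))

  QtyOf-without-other : ∀ {i j} → j ≢ i → ∀ T → QtyOf (without i T) j ≡ QtyOf T j
  QtyOf-without-other j≢i [] = refl
  QtyOf-without-other {i} {j} j≢i (t ∷ T) with key t ≟ i
  ... | yes p = begin
    QtyOf (without i (t ∷ T)) j ≡⟨ cong (λ X → QtyOf X j) (without-∷-same p) ⟩
    QtyOf (without i T) j       ≡⟨ QtyOf-without-other j≢i T ⟩
    QtyOf T j                   ≡⟨ QtyOf-∷-other (λ q → j≢i (trans (sym q) p)) ⟨
    QtyOf (t ∷ T) j             ∎
    where open ≡-Reasoning
  ... | no p = begin
    QtyOf (without i (t ∷ T)) j ≡⟨ cong (λ X → QtyOf X j) (without-∷-other p) ⟩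
    QtyOf (t ∷ without i T) j   ≡⟨ QtyOf-∷-cong t (QtyOf-without-other j≢i T) ⟩
    QtyOf (t ∷ T) j             ∎
    where open ≡-Reasoning

  Vol-≤-on-keys : ∀ ks T S → (∀ {t} → t ∈ T → key t ∈ ks) →
                  (∀ {j} → j ∈ ks → QtyOf T j ≤ QtyOf S j) → Vol T ≤ Vol S
  Vol-≤-on-keys [] []      _ _    _ = z≤n
  Vol-≤-on-keys [] (_ ∷ _) _ keys _ with () ← keys (here refl)
  Vol-≤-on-keys (i ∷ ks) T S keys dom = begin
    Vol T                         ≡⟨ Vol-split i T ⟩
    QtyOf T i + Vol (without i T) ≤⟨ +-mono-≤ (dom (here refl)) rest ⟩
    QtyOf S i + Vol (without i S) ≡⟨ Vol-split i S ⟨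
    Vol S                         ∎
    where
    open ≤-Reasoning
    keys′ : ∀ {t} → t ∈ without i T → key t ∈ ks
    keys′ t∈ with t∈T , key≢i ← ∈-filter⁻ (λ t → ¬? (key t ≟ i)) t∈ with keys t∈T
    ... | here key≡i = ⊥-elim (key≢i key≡i)
    ... | there k∈ks = k∈ks
    dom′ : ∀ {j} → j ∈ ks → QtyOf (without i T) j ≤ QtyOf (without i S) j
    dom′ {j} j∈ks with j ≟ i
    ... | yes refl = ≤-reflexive (trans (QtyOf-without-same i T) (sym (QtyOf-without-same i S)))
    ... | no j≢i rewrite QtyOf-without-other j≢i T | QtyOf-without-other j≢i S = dom (there j∈ks)
    rest : Vol (without i T) ≤ Vol (without i S)
    rest = Vol-≤-on-keys ks (without i T) (without i S) keys′ dom′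

  Vol-mono-keyed : ∀ T S → (∀ {t} → t ∈ T → QtyOf T (key t) ≤ QtyOf S (key t)) → Vol T ≤ Vol S
  Vol-mono-keyed T S dom = Vol-≤-on-keys (map key T) T S (∈-map⁺ key) dom′
    where
    dom′ : ∀ {j} → j ∈ map key T → QtyOf T j ≤ QtyOf S j
    dom′ j∈ with _ , t∈ , refl ← ∈-map⁻ key j∈ = dom t∈

Vol-≤-one-sided : ∀ (newKey oppKey : Transaction → ℕ) (ν : Order) {Opp : List Order}
  {TradableWithν : Order → Set} (M′ M : List Transaction) →
  (∀ {t} → t ∈ M′ → newKey t ≡ oid ν × ∃[ c ] (c ∈ Opp × oppKey t ≡ oid c × TradableWithν c)) →
  QtyOf newKey M′ (oid ν) ≤ qty ν →
  (∀ {c} → c ∈ Opp → QtyOf oppKey M′ (oid c) ≤ qty c) →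
  (QtyOf newKey M (oid ν) < qty ν → ∀ {c} → c ∈ Opp → TradableWithν c → qty c ≤ QtyOf oppKey M (oid c)) →
  Vol M′ ≤ Vol M
Vol-≤-one-sided newKey oppKey ν M′ M shape ν-bound opp-bound exhausted
  with qty ν ≤? QtyOf newKey M (oid ν)
... | yes filled = begin
  Vol M′                   ≡⟨ QtyOf-all newKey M′ (proj₁ ∘ shape) ⟨
  QtyOf newKey M′ (oid ν)  ≤⟨ ν-bound ⟩
  qty ν                    ≤⟨ filled ⟩
  QtyOf newKey M (oid ν)   ≤⟨ QtyOf≤Vol newKey M (oid ν) ⟩
  Vol M                    ∎
  where open ≤-Reasoning
... | no unfilled = Vol-mono-keyed oppKey M′ M dominated
  where
  dominated : ∀ {t} → t ∈ M′ → QtyOf oppKey M′ (oppKey t) ≤ QtyOf oppKey M (oppKey t)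
  dominated t∈ with _ , c , c∈ , key≡ , tradable ← shape t∈ rewrite key≡ =
    ≤-trans (opp-bound c∈) (exhausted (≰⇒> unfilled) c∈ tradable)

ValidTx⇒Matchable : ∀ {B A t} → ValidTx B A t → Matchable B A
ValidTx⇒Matchable (_ , b , a , b∈ , a∈ , _ , _ , tradable , _) = b , a , b∈ , a∈ , tradable

Matchable-mono : ∀ {B A B′ A′} → B ⊆ B′ → A ⊆ A′ → Matchable B A → Matchable B′ A′
Matchable-mono B⊆ A⊆ (b , a , b∈ , a∈ , tradable) = b , a , B⊆ b∈ , A⊆ a∈ , tradable

ValidTx-newBid : ∀ {β B A t} → ¬ Matchable B A → ValidTx (β ∷ B) A t →
  idBid t ≡ oid β × ∃[ a ] (a ∈ A × idAsk t ≡ oid a × Tradable β a)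
ValidTx-newBid _ (_ , _ , a , here refl , a∈ , bid≡ , ask≡ , tradable , _) = bid≡ , a , a∈ , ask≡ , tradable
ValidTx-newBid unmatchable (_ , b , a , there b∈ , a∈ , _ , _ , tradable , _) =
  ⊥-elim (unmatchable (b , a , b∈ , a∈ , tradable))

ValidTx-newAsk : ∀ {α B A t} → ¬ Matchable B A → ValidTx B (α ∷ A) t →
  idAsk t ≡ oid α × ∃[ b ] (b ∈ B × idBid t ≡ oid b × Tradable b α)
ValidTx-newAsk _ (_ , b , _ , b∈ , here refl , bid≡ , ask≡ , tradable , _) = ask≡ , b , b∈ , bid≡ , tradable
ValidTx-newAsk unmatchable (_ , b , a , b∈ , there a∈ , _ , _ , tradable , _) =
  ⊥-elim (unmatchable (b , a , b∈ , a∈ , tradable))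

sameOrder⇒oid≡ : ∀ ω ω′ → sameOrder ω ω′ ≡ true → oid ω ≡ oid ω′
sameOrder⇒oid≡ ω ω′ same = proj₁ (toWitness (subst T (sym same) tt))

multiplicity-tradedWith : ∀ Q M ω S → multiplicity ω (tradedWith Q M S) ≤ Q M (oid ω)
multiplicity-tradedWith Q M ω [] = z≤n
multiplicity-tradedWith Q M ω (ω′ ∷ S) with 0 <? Q M (oid ω′)
... | no _ = multiplicity-tradedWith Q M ω S
... | yes _ with sameOrder ω (withQty ω′ (Q M (oid ω′))) in same
...   | true  = ≤-reflexive (cong (Q M) (sym (sameOrder⇒oid≡ ω (withQty ω′ (Q M (oid ω′))) same)))
...   | false = multiplicity-tradedWith Q M ω S

∈-−ₘ : ∀ {ω S₁} S₂ → ω ∈ S₁ → 0 < qty ω ∸ multiplicity ω S₂ →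
       withQty ω (qty ω ∸ multiplicity ω S₂) ∈ S₁ −ₘ S₂
∈-−ₘ {ω} {ω′ ∷ S₁} S₂ (here refl) rest with 0 <? (qty ω ∸ multiplicity ω S₂)
... | yes _    = here refl
... | no ¬rest = ⊥-elim (¬rest rest)
∈-−ₘ {ω} {ω′ ∷ S₁} S₂ (there ω∈) rest with 0 <? (qty ω′ ∸ multiplicity ω′ S₂)
... | yes _ = there (∈-−ₘ S₂ ω∈ rest)
... | no _  = ∈-−ₘ S₂ ω∈ rest

unfilled-remains : ∀ Q M S′ {ω S} → ω ∈ S → Q M (oid ω) < qty ω →
                   ∃[ q ] withQty ω q ∈ S −ₘ tradedWith Q M S′
unfilled-remains Q M S′ {ω} ω∈ unfilled =
  _ , ∈-−ₘ (tradedWith Q M S′) ω∈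
        (m<n⇒0<n∸m (≤-<-trans (multiplicity-tradedWith Q M ω S′) unfilled))

module _ {P : Process} (spread : PositiveBidAskSpread P) (conserve : Conservation P)
         {B A τ} (legal : LegalInput B A τ) {B̂ Â M} (run : P B A τ ≡ (B̂ , Â , M)) where

  unfilled-not-tradable : ∀ {b a} → b ∈ fstP (Absorb B A τ) → a ∈ sndP (Absorb B A τ) →
    QtyBid M (oid b) < qty b → QtyAsk M (oid a) < qty a → ¬ Tradable b a
  unfilled-not-tradable b∈ a∈ b-unfilled a-unfilled tradable
    with _ , B̂≋ , Â≋ ← conserve B A τ legal B̂ Â M run
       | _ , b-rest ← unfilled-remains QtyBid M (fstP (Absorb B A τ)) b∈ b-unfilled
       | _ , a-rest ← unfilled-remains QtyAsk M (sndP (Absorb B A τ)) a∈ a-unfilled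
    = spread B A τ legal B̂ Â M run (_ , _ , proj₂ (B̂≋ _) b-rest , proj₂ (Â≋ _) a-rest , tradable)

lemma1 : (P : Process) → PositiveBidAskSpread P → Conservation P →
         ∀ B A τ → LegalInput B A τ →
         ∀ B̂ Â M → P B A τ ≡ (B̂ , Â , M) →
         ∀ M′ → Matching (fstP (Absorb B A τ)) (sndP (Absorb B A τ)) M′ →
         Vol M′ ≤ Vol M
lemma1 _ spread conserve _ _ (Buy β) legal@(_ , _ , _ , unmatchable , _) _ _ M run M′
       (_ , valid′ , bids′ , asks′) =
  Vol-≤-one-sided idBid idAsk β M′ M (λ t∈ → ValidTx-newBid unmatchable (valid′ _ t∈))
    (bids′ β (here refl)) (asks′ _)
    (λ β-unfilled a∈ tradable → ≮⇒≥ λ a-unfilled →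
       unfilled-not-tradable spread conserve legal run (here refl) a∈ β-unfilled a-unfilled tradable)
lemma1 _ spread conserve _ _ (Sell α) legal@(_ , _ , _ , unmatchable , _) _ _ M run M′
       (_ , valid′ , bids′ , asks′) =
  Vol-≤-one-sided idAsk idBid α M′ M (λ t∈ → ValidTx-newAsk unmatchable (valid′ _ t∈))
    (asks′ α (here refl)) (bids′ _)
    (λ α-unfilled b∈ tradable → ≮⇒≥ λ b-unfilled →
       unfilled-not-tradable spread conserve legal run b∈ (here refl) b-unfilled α-unfilled tradable)
lemma1 _ _ _ _ _ (Del _) _ _ _ _ _ [] _ = z≤n
lemma1 _ _ _ B A (Del _) (_ , _ , _ , unmatchable , _) _ _ _ _ (t ∷ _) (_ , valid′ , _) =
  ⊥-elim (unmatchable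
    (Matchable-mono (filter-⊆ _ B) (filter-⊆ _ A) (ValidTx⇒Matchable (valid′ t (here refl)))))
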